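{- For every finite group $G$, $|G|\le\mathrm{val}(G)\le|G|^{3/2}$.
   Context: A triple $(A,B,C)$ of subsets of a group $G$ (identity $1$) is equilateral trapezoid-free if for every fixed $a'\in A,b'\in B,c'\in C$, each of the following systems has at most one solution $(a,b,c)\in A\times B\times C$: $1=a'bc=ab'c$; $1=a'bc=abc'$; $1=ab'c=abc'$. $\mathrm{val}(G)$ is the maximum, over equilateral trapezoid-free triples, of the number of $(a,b,c)\in A\times B\times C$ with $abc=1$. -}

module Defs where

open import Data.Nat using (ℕ; zero; suc; _+_)
open import Data.Fin using (Fin)
open import Data.Fin.Subset using (Subset; _∈_)
open import Data.Fin.Subset.Properties using (_∈?_)
open import Data.Fin.Properties using (_≟_)
open import Data.List using (List; allFin; map)
open import Data.Nat.ListAction using (sum)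
open import Data.Product using (_×_; _,_)
open import Relation.Binary.PropositionalEquality using (_≡_)
open import Relation.Nullary using (Dec; yes; no)
open import Algebra.Structures using (IsGroup)

-- A finite group of order n: a group structure on Fin n (with propositional
-- equality).  Every finite group of order n is isomorphic to one of these.
record FinGroup (n : ℕ) : Set where
  field
    _∙_ : Fin n → Fin n → Fin n
    ε : Fin n
    _⁻¹ : Fin n → Fin n
    isGroup : IsGroup _≡_ _∙_ ε _⁻¹

module _ {n : ℕ} (G : FinGroup n) where
  open FinGroup G

  prod3 : Fin n → Fin n → Fin n → Fin n
  prod3 a b c = (a ∙ b) ∙ c

  AtMostOne : (A B C : Subset n) → (Fin n → Fin n → Fin n → Set) → Set
  AtMostOne A B C P =
    ∀ a₁ b₁ c₁ a₂ b₂ c₂ →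
      a₁ ∈ A → b₁ ∈ B → c₁ ∈ C → P a₁ b₁ c₁ →
      a₂ ∈ A → b₂ ∈ B → c₂ ∈ C → P a₂ b₂ c₂ →
      (a₁ , b₁ , c₁) ≡ (a₂ , b₂ , c₂)

  ETFree : (A B C : Subset n) → Set
  ETFree A B C =
    ∀ a' b' c' → a' ∈ A → b' ∈ B → c' ∈ C →
      AtMostOne A B C (λ a b c → prod3 a' b c ≡ ε × prod3 a b' c ≡ ε)
    × AtMostOne A B C (λ a b c → prod3 a' b c ≡ ε × prod3 a b c' ≡ ε)
    × AtMostOne A B C (λ a b c → prod3 a b' c ≡ ε × prod3 a b c' ≡ ε)

  ind : (A B C : Subset n) → Fin n → Fin n → Fin n → ℕ
  ind A B C a b c with a ∈? A | b ∈? B | c ∈? C | prod3 a b c ≟ ε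
  ... | yes _ | yes _ | yes _ | yes _ = 1
  ... | _ | _ | _ | _ = 0

  count : (A B C : Subset n) → ℕ
  count A B C =
    sum (map (λ a → sum (map (λ b → sum (map (λ c → ind A B C a b c)
      (allFin n))) (allFin n))) (allFin n))

{-# OPTIONS --safe #-}
-- Lower bound: for A = C = G and B = {1} the solutions are the n triples
-- (a, 1, a⁻¹); in each of the three systems b = 1 is forced and one of a, c
-- is pinned by the fixed element, which determines the other.
-- Upper bound: let D(a) be the number of solutions through a.  By
-- Cauchy–Schwarz, count² ≤ n · Σₐ D(a)², and Σₐ D(a)² counts pairs of
-- solutions (a,b,c), (a,b′,c′) sharing a.  For fixed b and c′ such a pair is
-- a solution (a,b′,c) of the third system with fixed elements b and c′, so
-- there is at most one, whence Σₐ D(a)² ≤ n².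
module Submission where

open import Defs
open import Data.Nat using (ℕ; zero; suc; _+_; _*_; _^_; _≤_; _>_; z≤n; z<s)
open import Data.Nat.Properties hiding (_≟_; suc-injective)
open import Data.Nat.Solver using (module +-*-Solver)
import Data.Nat.ListAction as List
open import Data.Fin using (Fin; zero; suc)
open import Data.Fin.Properties using (_≟_; suc-injective)
open import Data.Fin.Subset using (Subset; _∈_; ⊤; ⁅_⁆)
open import Data.Fin.Subset.Properties using (_∈?_; ∈⊤; x∈⁅x⁆; x∈⁅y⁆⇒x≡y)
open import Data.List using (tabulate; allFin; map)
open import Data.List.Properties using (map-tabulate)
open import Data.Product using (Σ; ∃; _×_; _,_; proj₁; proj₂)
open import Data.Sum using (_⊎_; inj₁; inj₂; [_,_]′)
open import Function using (_∘_)
open import Relation.Binary.PropositionalEquality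
open import Relation.Nullary using (yes; no; contradiction)
open import Algebra.Bundles using (Group)
open import Algebra.Structures using (IsGroup)
open import Level using (0ℓ)
import Algebra.Properties.Group as GroupProperties
open import Algebra.Properties.Semiring.Sum +-*-semiring
  using (sum; sum-syntax; sum-cong-≗; ∑-comm; ∑-distrib-+; *-distribˡ-sum; *-distribʳ-sum)

private
  variable
    l m n : ℕ

∑-const : ∀ n k → ∑[ i < n ] k ≡ n * k
∑-const zero    k = refl
∑-const (suc n) k = cong (k +_) (∑-const n k)

∑-mono-≤ : {f g : Fin n → ℕ} → (∀ i → f i ≤ g i) → sum f ≤ sum g
∑-mono-≤ {zero}  f≤g = z≤n
∑-mono-≤ {suc n} f≤g = +-mono-≤ (f≤g zero) (∑-mono-≤ (f≤g ∘ suc))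

term≤∑ : (f : Fin n → ℕ) (i : Fin n) → f i ≤ sum f
term≤∑ f zero    = m≤m+n _ _
term≤∑ f (suc i) = ≤-trans (term≤∑ (f ∘ suc) i) (m≤n+m _ _)

∑-positive : (f : Fin n → ℕ) → sum f > 0 → ∃ λ i → f i > 0
∑-positive {zero}  f ()
∑-positive {suc n} f ∑f>0 with f zero in f₀≡
... | suc _ = zero , subst (_> 0) (sym f₀≡) z<s
... | zero  with ∑-positive (f ∘ suc) ∑f>0
...   | i , fᵢ>0 = suc i , fᵢ>0

∑-≤1 : (f : Fin n → ℕ) → (∀ i → f i ≤ 1) →
       (∀ i j → f i > 0 → f j > 0 → i ≡ j) → sum f ≤ 1
∑-≤1 {zero}  f f≤1 unique = z≤n
∑-≤1 {suc n} f f≤1 unique with f zero in f₀≡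
... | zero  = ∑-≤1 (f ∘ suc) (f≤1 ∘ suc)
                (λ i j fᵢ>0 fⱼ>0 → suc-injective (unique _ _ fᵢ>0 fⱼ>0))
... | suc k = begin
    suc k + sum (f ∘ suc) ≡⟨ cong (suc k +_) (sum-cong-≗ tail≡0) ⟩
    suc k + ∑[ i < n ] 0  ≡⟨ cong (suc k +_) (trans (∑-const n 0) (*-zeroʳ n)) ⟩
    suc k + 0             ≡⟨ trans (+-identityʳ _) (sym f₀≡) ⟩
    f zero                ≤⟨ f≤1 zero ⟩
    1                     ∎
  where
  open ≤-Reasoning
  f₀>0 : f zero > 0
  f₀>0 = subst (_> 0) (sym f₀≡) z<s
  tail≡0 : ∀ i → f (suc i) ≡ 0
  tail≡0 i with f (suc i) in fᵢ≡
  ... | zero  = refl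
  ... | suc _ = contradiction (unique _ _ f₀>0 (subst (_> 0) (sym fᵢ≡) z<s)) λ ()

∑∑∑-≤1 : (f : Fin l → Fin m → Fin n → ℕ) → (∀ x y z → f x y z ≤ 1) →
         (∀ x y z x′ y′ z′ → f x y z > 0 → f x′ y′ z′ > 0 → (x , y , z) ≡ (x′ , y′ , z′)) →
         ∑[ x < l ] ∑[ y < m ] ∑[ z < n ] f x y z ≤ 1
∑∑∑-≤1 f f≤1 unique = ∑-≤1 _ ∑∑≤1 λ x x′ p q →
  let y , p′ = ∑-positive _ p ; z , p″ = ∑-positive _ p′
      y′ , q′ = ∑-positive _ q ; z′ , q″ = ∑-positive _ q′
  in cong proj₁ (unique x y z x′ y′ z′ p″ q″)
  where
  ∑≤1 : ∀ x y → ∑[ z < _ ] f x y z ≤ 1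
  ∑≤1 x y = ∑-≤1 _ (f≤1 x y) λ z z′ p q → cong (proj₂ ∘ proj₂) (unique x y z x y z′ p q)
  ∑∑≤1 : ∀ x → ∑[ y < _ ] ∑[ z < _ ] f x y z ≤ 1
  ∑∑≤1 x = ∑-≤1 _ (∑≤1 x) λ y y′ p q →
    let z , p′ = ∑-positive _ p ; z′ , q′ = ∑-positive _ q
    in cong (proj₁ ∘ proj₂) (unique x y z x y′ z′ p′ q′)

∑-*-∑ : (f : Fin m → ℕ) (g : Fin n → ℕ) →
        sum f * sum g ≡ ∑[ i < m ] ∑[ j < n ] (f i * g j)
∑-*-∑ f g = trans (*-distribʳ-sum (sum g) f)
                  (sum-cong-≗ λ i → *-distribˡ-sum (f i) g)

listSum-map-allFin : ∀ n (f : Fin n → ℕ) → List.sum (map f (allFin n)) ≡ sum f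
listSum-map-allFin n f = trans (cong List.sum (map-tabulate {n = n} (λ i → i) f)) (listSum-tabulate f)
  where
  listSum-tabulate : ∀ {n} (f : Fin n → ℕ) → List.sum (tabulate f) ≡ sum f
  listSum-tabulate {zero}  f = refl
  listSum-tabulate {suc n} f = cong (f zero +_) (listSum-tabulate (f ∘ suc))

2*m*n≤m*m+n*n : ∀ m n → 2 * (m * n) ≤ m * m + n * n
2*m*n≤m*m+n*n m n = [ ordered , swapped ]′ (≤-total m n)
  where
  open +-*-Solver
  ordered : ∀ {m n} → m ≤ n → 2 * (m * n) ≤ m * m + n * n
  ordered {m} m≤n with m≤n⇒∃[o]m+o≡n m≤n
  ... | d , refl = subst (2 * (m * (m + d)) ≤_)
    (solve 2 (λ m d → con 2 :* (m :* (m :+ d)) :+ d :* d := m :* m :+ (m :+ d) :* (m :+ d)) refl m d)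
    (m≤m+n _ _)
  swapped : n ≤ m → 2 * (m * n) ≤ m * m + n * n
  swapped n≤m = subst₂ _≤_ (cong (2 *_) (*-comm n m)) (+-comm (n * n) (m * m)) (ordered n≤m)

cauchy-schwarz : (d : Fin n → ℕ) → sum d * sum d ≤ n * ∑[ i < n ] (d i * d i)
cauchy-schwarz {n} d = *-cancelˡ-≤ 2 (begin
  2 * (sum d * sum d)                                 ≡⟨ cong (2 *_) (∑-*-∑ d d) ⟩
  2 * ∑[ i < n ] ∑[ j < n ] (d i * d j)               ≡⟨ *-distribˡ-sum 2 (λ i → ∑[ j < n ] (d i * d j)) ⟩
  ∑[ i < n ] (2 * ∑[ j < n ] (d i * d j))             ≡⟨ sum-cong-≗ (λ i → *-distribˡ-sum 2 (λ j → d i * d j)) ⟩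
  ∑[ i < n ] ∑[ j < n ] (2 * (d i * d j))             ≤⟨ ∑-mono-≤ (λ i → ∑-mono-≤ λ j → 2*m*n≤m*m+n*n (d i) (d j)) ⟩
  ∑[ i < n ] ∑[ j < n ] (d i * d i + d j * d j)       ≡⟨ sum-cong-≗ (λ i → ∑-distrib-+ (λ _ → d i * d i) (λ j → d j * d j)) ⟩
  ∑[ i < n ] (∑[ j < n ] (d i * d i) + Q)             ≡⟨ ∑-distrib-+ (λ i → ∑[ j < n ] (d i * d i)) (λ _ → Q) ⟩
  ∑[ i < n ] ∑[ j < n ] (d i * d i) + ∑[ i < n ] Q    ≡⟨ cong₂ _+_ (sum-cong-≗ λ i → ∑-const n (d i * d i)) (∑-const n Q) ⟩
  ∑[ i < n ] (n * (d i * d i)) + n * Q                ≡⟨ cong (_+ n * Q) (sym (*-distribˡ-sum n (λ i → d i * d i))) ⟩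
  n * Q + n * Q                                       ≡⟨ cong (n * Q +_) (sym (+-identityʳ (n * Q))) ⟩
  2 * (n * Q)                                         ∎)
  where
  open ≤-Reasoning
  Q = ∑[ i < n ] (d i * d i)

m*n>0⇒m>0∧n>0 : ∀ m n → m * n > 0 → m > 0 × n > 0
m*n>0⇒m>0∧n>0 zero    n       ()
m*n>0⇒m>0∧n>0 (suc m) (suc n) _    = z<s , z<s
m*n>0⇒m>0∧n>0 (suc m) zero    mn>0 = contradiction (subst (_> 0) (*-zeroʳ m) mn>0) λ ()

module _ (G : FinGroup n) where
  open FinGroup G
  open IsGroup isGroup using (identityʳ; inverseʳ)

  group : Group 0ℓ 0ℓ
  group = record { isGroup = isGroup }

  open GroupProperties group using (∙-cancelˡ; ∙-cancelʳ)

  module _ (A B C : Subset n) where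

    Solution : Fin n → Fin n → Fin n → Set
    Solution a b c = a ∈ A × b ∈ B × c ∈ C × prod3 G a b c ≡ ε

    ind≤1 : ∀ a b c → ind G A B C a b c ≤ 1
    ind≤1 a b c with a ∈? A | b ∈? B | c ∈? C | prod3 G a b c ≟ ε
    ... | yes _ | yes _ | yes _ | yes _ = ≤-refl
    ... | yes _ | yes _ | yes _ | no  _ = z≤n
    ... | yes _ | yes _ | no  _ | _     = z≤n
    ... | yes _ | no  _ | _     | _     = z≤n
    ... | no  _ | _     | _     | _     = z≤n

    ind>0⇒Solution : ∀ a b c → ind G A B C a b c > 0 → Solution a b c
    ind>0⇒Solution a b c ind>0 with a ∈? A | b ∈? B | c ∈? C | prod3 G a b c ≟ ε
    ... | yes a∈A | yes b∈B | yes c∈C | yes abc≡ε = a∈A , b∈B , c∈C , abc≡ε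

    Solution⇒ind≡1 : ∀ a b c → Solution a b c → ind G A B C a b c ≡ 1
    Solution⇒ind≡1 a b c (a∈A , b∈B , c∈C , abc≡ε)
      with a ∈? A | b ∈? B | c ∈? C | prod3 G a b c ≟ ε
    ... | yes _ | yes _ | yes _ | yes _   = refl
    ... | yes _ | yes _ | yes _ | no abc≢ε = contradiction abc≡ε abc≢ε
    ... | yes _ | yes _ | no c∉C | _      = contradiction c∈C c∉C
    ... | yes _ | no b∉B | _     | _      = contradiction b∈B b∉B
    ... | no a∉A | _     | _     | _      = contradiction a∈A a∉A

    count≡∑∑∑ind : count G A B C ≡ ∑[ a < n ] ∑[ b < n ] ∑[ c < n ] ind G A B C a b c
    count≡∑∑∑ind = trans (listSum-map-allFin n _) (sum-cong-≗ {n} λ a →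
                   trans (listSum-map-allFin n _) (sum-cong-≗ {n} λ b →
                   listSum-map-allFin n _))

    private
      I : Fin n → Fin n → Fin n → ℕ
      I = ind G A B C

    solutionsThrough : Fin n → ℕ
    solutionsThrough a = ∑[ b < n ] ∑[ c < n ] I a b c

    module _ (etFree : ETFree G A B C) where

      solutionPairs≤1 : ∀ b c′ → ∑[ a < n ] ∑[ b′ < n ] ∑[ c < n ] (I a b c * I a b′ c′) ≤ 1
      solutionPairs≤1 b c′ = ∑∑∑-≤1 _ (λ a b′ c → *-mono-≤ (ind≤1 a b c) (ind≤1 a b′ c′)) unique
        where
        unique : ∀ a₁ b′₁ c₁ a₂ b′₂ c₂ → I a₁ b c₁ * I a₁ b′₁ c′ > 0 → I a₂ b c₂ * I a₂ b′₂ c′ > 0 →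
                 (a₁ , b′₁ , c₁) ≡ (a₂ , b′₂ , c₂)
        unique a₁ b′₁ c₁ a₂ b′₂ c₂ p₁ p₂
          with m*n>0⇒m>0∧n>0 _ _ p₁ | m*n>0⇒m>0∧n>0 _ _ p₂
        ... | q₁ , r₁ | q₂ , r₂
          with ind>0⇒Solution _ _ _ q₁ | ind>0⇒Solution _ _ _ r₁
             | ind>0⇒Solution _ _ _ q₂ | ind>0⇒Solution _ _ _ r₂
        ... | a₁∈ , b∈ , c₁∈ , e₁ | _ , b′₁∈ , c′∈ , f₁ | a₂∈ , _ , c₂∈ , e₂ | _ , b′₂∈ , _ , f₂ =
          proj₂ (proj₂ (etFree a₁ b c′ a₁∈ b∈ c′∈))
            a₁ b′₁ c₁ a₂ b′₂ c₂ a₁∈ b′₁∈ c₁∈ (e₁ , f₁) a₂∈ b′₂∈ c₂∈ (e₂ , f₂)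

      ∑solutionsThrough²≤n² : ∑[ a < n ] (solutionsThrough a * solutionsThrough a) ≤ n * n
      ∑solutionsThrough²≤n² = begin
        ∑[ a < n ] (solutionsThrough a * solutionsThrough a)                    ≡⟨ sum-cong-≗ {n} square ⟩
        ∑[ a < n ] ∑[ b < n ] ∑[ b′ < n ] ∑[ c < n ] ∑[ c′ < n ] F a b c b′ c′ ≡⟨ reorder ⟩
        ∑[ b < n ] ∑[ c′ < n ] ∑[ a < n ] ∑[ b′ < n ] ∑[ c < n ] F a b c b′ c′ ≤⟨ ∑-mono-≤ (λ b → ∑-mono-≤ (solutionPairs≤1 b)) ⟩
        ∑[ b < n ] ∑[ c′ < n ] 1                                                ≡⟨ trans (sum-cong-≗ {n} λ _ → ∑-const n 1) (∑-const n (n * 1)) ⟩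
        n * (n * 1)                                                             ≡⟨ cong (n *_) (*-identityʳ n) ⟩
        n * n                                                                   ∎
        where
        open ≤-Reasoning
        F : Fin n → Fin n → Fin n → Fin n → Fin n → ℕ
        F a b c b′ c′ = I a b c * I a b′ c′
        square : ∀ a → solutionsThrough a * solutionsThrough a ≡
                       ∑[ b < n ] ∑[ b′ < n ] ∑[ c < n ] ∑[ c′ < n ] F a b c b′ c′
        square a = trans (∑-*-∑ (λ b → ∑[ c < n ] I a b c) (λ b′ → ∑[ c′ < n ] I a b′ c′))
                         (sum-cong-≗ λ b → sum-cong-≗ λ b′ → ∑-*-∑ (I a b) (I a b′))
        reorder : ∑[ a < n ] ∑[ b < n ] ∑[ b′ < n ] ∑[ c < n ] ∑[ c′ < n ] F a b c b′ c′ ≡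
                  ∑[ b < n ] ∑[ c′ < n ] ∑[ a < n ] ∑[ b′ < n ] ∑[ c < n ] F a b c b′ c′
        reorder = trans (sum-cong-≗ λ a → sum-cong-≗ λ b →
                    trans (sum-cong-≗ λ b′ → ∑-comm λ c c′ → F a b c b′ c′)
                          (∑-comm λ b′ c′ → ∑[ c < n ] F a b c b′ c′))
                  (trans (∑-comm λ a b → ∑[ c′ < n ] ∑[ b′ < n ] ∑[ c < n ] F a b c b′ c′)
                         (sum-cong-≗ λ b → ∑-comm λ a c′ → ∑[ b′ < n ] ∑[ c < n ] F a b c b′ c′))

      count²≤n³ : count G A B C ^ 2 ≤ n ^ 3
      count²≤n³ = begin
        count G A B C ^ 2                                        ≡⟨ cong (_^ 2) count≡∑∑∑ind ⟩
        sum solutionsThrough ^ 2                                 ≡⟨ cong (sum solutionsThrough *_) (*-identityʳ _) ⟩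
        sum solutionsThrough * sum solutionsThrough              ≤⟨ cauchy-schwarz solutionsThrough ⟩
        n * ∑[ a < n ] (solutionsThrough a * solutionsThrough a) ≤⟨ *-monoʳ-≤ n ∑solutionsThrough²≤n² ⟩
        n * (n * n)                                              ≡⟨ cong (λ k → n * (n * k)) (sym (*-identityʳ n)) ⟩
        n ^ 3                                                    ∎
        where open ≤-Reasoning

  a∙ε∙a⁻¹≡ε : ∀ a → prod3 G a ε (a ⁻¹) ≡ ε
  a∙ε∙a⁻¹≡ε a = trans (cong (_∙ (a ⁻¹)) (identityʳ a)) (inverseʳ a)

  a∙ε∙c≡ε-injectiveˡ : ∀ {a₁ a₂ c} → prod3 G a₁ ε c ≡ ε → prod3 G a₂ ε c ≡ ε → a₁ ≡ a₂
  a∙ε∙c≡ε-injectiveˡ {a₁} {a₂} {c} e₁ e₂ =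
    ∙-cancelʳ ε a₁ a₂ (∙-cancelʳ c (a₁ ∙ ε) (a₂ ∙ ε) (trans e₁ (sym e₂)))

  a∙ε∙c≡ε-injectiveʳ : ∀ {a c₁ c₂} → prod3 G a ε c₁ ≡ ε → prod3 G a ε c₂ ≡ ε → c₁ ≡ c₂
  a∙ε∙c≡ε-injectiveʳ {a} {c₁} {c₂} e₁ e₂ = ∙-cancelˡ (a ∙ ε) c₁ c₂ (trans e₁ (sym e₂))

  a∙ε∙c≡ε-unique : ∀ {a₁ a₂ c₁ c₂} → prod3 G a₁ ε c₁ ≡ ε → prod3 G a₂ ε c₂ ≡ ε →
                   a₁ ≡ a₂ ⊎ c₁ ≡ c₂ → a₁ ≡ a₂ × c₁ ≡ c₂
  a∙ε∙c≡ε-unique e₁ e₂ (inj₁ refl) = refl , a∙ε∙c≡ε-injectiveʳ e₁ e₂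
  a∙ε∙c≡ε-unique e₁ e₂ (inj₂ refl) = a∙ε∙c≡ε-injectiveˡ e₁ e₂ , refl

  AtMostOne-⊤-⁅ε⁆-⊤ : (P : Fin n → Fin n → Fin n → Set) →
                       (∀ {a₁ c₁ a₂ c₂} → P a₁ ε c₁ → P a₂ ε c₂ → a₁ ≡ a₂ × c₁ ≡ c₂) →
                       AtMostOne G ⊤ ⁅ ε ⁆ ⊤ P
  AtMostOne-⊤-⁅ε⁆-⊤ P unique a₁ b₁ c₁ a₂ b₂ c₂ _ b₁∈ _ p₁ _ b₂∈ _ p₂
    with refl ← x∈⁅y⁆⇒x≡y ε b₁∈ | refl ← x∈⁅y⁆⇒x≡y ε b₂∈
    with refl , refl ← unique p₁ p₂ = refl

  ETFree-⊤-⁅ε⁆-⊤ : ETFree G ⊤ ⁅ ε ⁆ ⊤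
  ETFree-⊤-⁅ε⁆-⊤ a′ b′ c′ _ b′∈ _ with refl ← x∈⁅y⁆⇒x≡y ε b′∈ =
      AtMostOne-⊤-⁅ε⁆-⊤ _ (λ (e₁ , f₁) (e₂ , f₂) → a∙ε∙c≡ε-unique f₁ f₂ (inj₂ (a∙ε∙c≡ε-injectiveʳ e₁ e₂)))
    , AtMostOne-⊤-⁅ε⁆-⊤ _ (λ (e₁ , f₁) (e₂ , f₂) → a∙ε∙c≡ε-injectiveˡ f₁ f₂ , a∙ε∙c≡ε-injectiveʳ e₁ e₂)
    , AtMostOne-⊤-⁅ε⁆-⊤ _ (λ (e₁ , f₁) (e₂ , f₂) → a∙ε∙c≡ε-unique e₁ e₂ (inj₁ (a∙ε∙c≡ε-injectiveˡ f₁ f₂)))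

  n≤count-⊤-⁅ε⁆-⊤ : n ≤ count G ⊤ ⁅ ε ⁆ ⊤
  n≤count-⊤-⁅ε⁆-⊤ = begin
    n                                       ≡⟨ trans (sym (*-identityʳ n)) (sym (∑-const n 1)) ⟩
    ∑[ a < n ] 1                            ≤⟨ ∑-mono-≤ 1≤solutionsThrough ⟩
    ∑[ a < n ] solutionsThrough ⊤ ⁅ ε ⁆ ⊤ a ≡⟨ sym (count≡∑∑∑ind ⊤ ⁅ ε ⁆ ⊤) ⟩
    count G ⊤ ⁅ ε ⁆ ⊤                       ∎
    where
    open ≤-Reasoning
    I = ind G ⊤ ⁅ ε ⁆ ⊤
    1≤solutionsThrough : ∀ a → 1 ≤ solutionsThrough ⊤ ⁅ ε ⁆ ⊤ a
    1≤solutionsThrough a = begin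
      1                                ≡⟨ sym (Solution⇒ind≡1 ⊤ ⁅ ε ⁆ ⊤ a ε (a ⁻¹) (∈⊤ , x∈⁅x⁆ ε , ∈⊤ , a∙ε∙a⁻¹≡ε a)) ⟩
      I a ε (a ⁻¹)                     ≤⟨ term≤∑ (I a ε) (a ⁻¹) ⟩
      ∑[ c < n ] I a ε c               ≤⟨ term≤∑ (λ b → ∑[ c < n ] I a b c) ε ⟩
      ∑[ b < n ] ∑[ c < n ] I a b c    ∎

proposition3p4 : ∀ (n : ℕ) (G : FinGroup n) →
    Σ (Subset n) (λ A → Σ (Subset n) (λ B → Σ (Subset n) (λ C →
        ETFree G A B C × n ≤ count G A B C)))
    × (∀ (A B C : Subset n) → ETFree G A B C → count G A B C ^ 2 ≤ n ^ 3)
proposition3p4 n G =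
    (⊤ , ⁅ ε ⁆ , ⊤ , ETFree-⊤-⁅ε⁆-⊤ G , n≤count-⊤-⁅ε⁆-⊤ G)
  , λ A B C → count²≤n³ G A B C
  where open FinGroup G using (ε)
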